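{- Let $n\geqslant 5$ and let $u$ be an even vertex of $\text{CQ}_n$. Then the $P_4$-graph of $N(u)$ (with respect to $G=\text{CQ}_n$) contains a complete subgraph $K_4$.
   Context: Two 2-bit strings $x_2x_1$ and $y_2y_1$ are pair related, written $x_2x_1\sim y_2y_1$, iff $(x_2x_1,y_2y_1)\in\{(00,00),(10,10),(01,11),(11,01)\}$. The $n$-dimensional crossed cube $\text{CQ}_n$ has as vertices all binary strings $u=u_{n-1}\ldots u_0$ of length $n$. Two vertices $u,v$ are adjacent iff there is an index $x$ with $0\leqslant x\leqslant n-1$ such that: (1) $v_x\neq u_x$; (2) if $x$ is odd, $v_{x-1}=u_{x-1}$; (3) $v_i=u_i$ for all $i>x$; (4) $u_{2i+1}u_{2i}\sim v_{2i+1}v_{2i}$ for all $0\leqslant i\leqslant\lfloor x/2\rfloor-1$. A vertex $u$ is even (resp. odd) if $u_0=0$ (resp. $u_0=1$). $N(u)$ is the set of neighbours of $u$. A $P_4$ from $x$ to $y$ in $G$ is a path in $G$ on four distinct vertices with endpoints $x$ and $y$. The $P_4$-graph of a set $S\subseteq V(G)$ is the graph $H$ with $V(H)=S$ in which $x,y\in S$ are adjacent iff there is a $P_4$ from $x$ to $y$ in $G$. -}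

module Defs where

open import Data.Bool using (Bool; true; false)
open import Data.Nat using (ℕ; zero; suc; _+_; _*_; _<_; _≤_; _/_; _%_)
open import Data.Fin using (Fin; toℕ)
open import Data.Vec using (Vec; lookup)
open import Data.Product using (Σ; _×_; ∃; ∃-syntax; _,_)
open import Relation.Nullary using (¬_)
open import Relation.Binary.PropositionalEquality using (_≡_; _≢_)

-- A vertex u = u_{n-1} … u_0 of CQ_n is a vector whose entry at index i is u_i
-- (so  lookup u i  is the bit u_i).
Vertex : ℕ → Set
Vertex n = Vec Bool n

-- Pair relation on 2-bit strings:  x₂x₁ ∼ y₂y₁  (arguments x₂ x₁ y₂ y₁).
data PairRel : Bool → Bool → Bool → Bool → Set where
  pr00 : PairRel false false false false
  pr10 : PairRel true  false true  false
  pr01 : PairRel false true  true  true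
  pr11 : PairRel true  true  false true

record AdjAt {n : ℕ} (u v : Vertex n) (x : Fin n) : Set where
  field
    differ : lookup v x ≢ lookup u x
    odd-cond : toℕ x % 2 ≡ 1 → (j : Fin n) → suc (toℕ j) ≡ toℕ x → lookup v j ≡ lookup u j
    high-eq : (i : Fin n) → toℕ x < toℕ i → lookup v i ≡ lookup u i
    pairs : (i : ℕ) → i < toℕ x / 2 → (j k : Fin n) → toℕ j ≡ suc (2 * i) → toℕ k ≡ 2 * i →
            PairRel (lookup u j) (lookup u k) (lookup v j) (lookup v k)

CQAdj : (n : ℕ) → Vertex n → Vertex n → Set
CQAdj n u v = ∃[ x ] AdjAt u v x

Even : {n : ℕ} → Vertex n → Set
Even {n} u = (i : Fin n) → toℕ i ≡ 0 → lookup u i ≡ false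

P4 : {V : Set} → (V → V → Set) → V → V → Set
P4 {V} Adj x y = Σ V λ b → Σ V λ c →
  (Adj x b × Adj b c × Adj c y) ×
  (x ≢ b × x ≢ c × x ≢ y × b ≢ c × b ≢ y × c ≢ y)

P4GraphAdj : {V : Set} → (V → V → Set) → (S : V → Set) → Σ V S → Σ V S → Set
P4GraphAdj Adj S (x , _) (y , _) = P4 Adj x y

HasK4 : {W : Set} → (W → W → Set) → Set
HasK4 {W} E = Σ W λ a → Σ W λ b → Σ W λ c → Σ W λ d →
  (a ≢ b × a ≢ c × a ≢ d × b ≢ c × b ≢ d × c ≢ d) ×
  (E a b × E a c × E a d × E b c × E b d × E c d)

-- For an even vertex u the lowest pair u₁u₀ = b0 is ∼-fixed, so the neighbours
-- u⁰, u¹, u², u³ of u along the dimensions 0 … 3 are u with a single bit flipped.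
-- Any two of them are joined by a walk of length three along low dimensions (e.g.
-- dimensions 0, 2, 0 lead from u¹ to u², and 4, 2, 4 from u² to u³); it is the
-- twisting by ∼ that makes these walks close up. The four vertices of each walk
-- are distinct: consecutive ones are adjacent, the others differ in bit 0 or in
-- one of the bits flipped from u.
module Submission where

open import Defs
open import Data.Nat using (ℕ; suc; _≤_; _+_; z≤n; s≤s)
open import Data.Bool using (Bool; true; false; not; _xor_)
open import Data.Bool.Properties using (not-involutive; not-¬)
open import Data.Fin using (Fin; toℕ; _↑ˡ_) renaming (suc to fsuc)
open import Data.Fin.Patterns using (0F; 1F; 2F; 3F; 4F)
open import Data.Fin.Properties using (toℕ-injective)
open import Data.Vec using (Vec; _∷_; lookup)
open import Data.Product using (_,_; proj₁)
open import Relation.Binary.PropositionalEquality using (_≡_; _≢_; refl; cong; subst; ≢-sym)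

P4⇒≢ : {V : Set} {Adj : V → V → Set} {x y : V} → P4 Adj x y → x ≢ y
P4⇒≢ (_ , _ , _ , _ , _ , x≢y , _) = x≢y

P4-from-walk : {V : Set} {Adj : V → V → Set} → (∀ {x y} → Adj x y → x ≢ y) →
               {x b c y : V} → Adj x b → Adj b c → Adj c y →
               x ≢ c → b ≢ y → x ≢ y → P4 Adj x y
P4-from-walk irrefl {b = b} {c} xb bc cy x≢c b≢y x≢y =
  b , c , (xb , bc , cy) , (irrefl xb , x≢c , x≢y , irrefl bc , b≢y , irrefl cy)

K4-from-P4-clique : {V : Set} {Adj : V → V → Set} {S : V → Set} {a b c d : V} →
                    S a → S b → S c → S d →
                    P4 Adj a b → P4 Adj a c → P4 Adj a d →
                    P4 Adj b c → P4 Adj b d → P4 Adj c d →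
                    HasK4 (P4GraphAdj Adj S)
K4-from-P4-clique sa sb sc sd ab ac ad bc bd cd =
  (_ , sa) , (_ , sb) , (_ , sc) , (_ , sd) ,
  (distinct ab , distinct ac , distinct ad , distinct bc , distinct bd , distinct cd) ,
  (ab , ac , ad , bc , bd , cd)
  where
  distinct : ∀ {x y sx sy} → P4 _ x y → (x , sx) ≢ (y , sy)
  distinct p q = P4⇒≢ p (cong proj₁ q)

CQAdj-irreflexive : ∀ {n} {u v : Vertex n} → CQAdj n u v → u ≢ v
CQAdj-irreflexive (_ , adj) refl = AdjAt.differ adj refl

lookup-≢⇒≢ : ∀ {A : Set} {n} {u v : Vec A n} (i : Fin n) → lookup u i ≢ lookup v i → u ≢ v
lookup-≢⇒≢ i ui≢vi refl = ui≢vi refl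

not-≢-self : ∀ b → not b ≢ b
not-≢-self b = ≢-sym (not-¬ refl)

∼-partner : ∀ x₂ x₁ → PairRel x₂ x₁ (x₁ xor x₂) x₁
∼-partner false false = pr00
∼-partner true  false = pr10
∼-partner false true  = pr01
∼-partner true  true  = pr11

-- The neighbour along dimension i: bit i is flipped, and every lower pair
-- u₂ⱼ₊₁u₂ⱼ is replaced by its unique ∼-partner (u₂ⱼ₊₁ flips iff u₂ⱼ = 1).
neighbour : ∀ {m} → Fin 5 → Vertex (5 + m) → Vertex (5 + m)
neighbour 0F (u₀ ∷ u₁ ∷ u₂ ∷ u₃ ∷ u₄ ∷ r) = not u₀ ∷ u₁ ∷ u₂ ∷ u₃ ∷ u₄ ∷ r
neighbour 1F (u₀ ∷ u₁ ∷ u₂ ∷ u₃ ∷ u₄ ∷ r) = u₀ ∷ not u₁ ∷ u₂ ∷ u₃ ∷ u₄ ∷ r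
neighbour 2F (u₀ ∷ u₁ ∷ u₂ ∷ u₃ ∷ u₄ ∷ r) = u₀ ∷ (u₀ xor u₁) ∷ not u₂ ∷ u₃ ∷ u₄ ∷ r
neighbour 3F (u₀ ∷ u₁ ∷ u₂ ∷ u₃ ∷ u₄ ∷ r) = u₀ ∷ (u₀ xor u₁) ∷ u₂ ∷ not u₃ ∷ u₄ ∷ r
neighbour 4F (u₀ ∷ u₁ ∷ u₂ ∷ u₃ ∷ u₄ ∷ r) = u₀ ∷ (u₀ xor u₁) ∷ u₂ ∷ (u₂ xor u₃) ∷ not u₄ ∷ r

PairRelAt : ∀ {n} → Vertex n → Vertex n → Fin n → Fin n → Set
PairRelAt u v j k = PairRel (lookup u j) (lookup u k) (lookup v j) (lookup v k)

PairRelAt-by-toℕ : ∀ {n} (u v : Vertex n) (j′ k′ : Fin n) {j k : Fin n} → PairRelAt u v j′ k′ →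
                   toℕ j ≡ toℕ j′ → toℕ k ≡ toℕ k′ → PairRelAt u v j k
PairRelAt-by-toℕ _ _ _ _ p j≡j′ k≡k′ rewrite toℕ-injective j≡j′ | toℕ-injective k≡k′ = p

neighbour-AdjAt : ∀ {m} (i : Fin 5) (u : Vertex (5 + m)) → AdjAt u (neighbour i u) (i ↑ˡ m)
neighbour-AdjAt 0F u@(u₀ ∷ u₁ ∷ u₂ ∷ u₃ ∷ u₄ ∷ r) = record
  { differ   = not-≢-self u₀
  ; odd-cond = λ ()
  ; high-eq  = λ { 0F () ; (fsuc _) _ → refl }
  ; pairs    = λ _ ()
  }
neighbour-AdjAt 1F u@(u₀ ∷ u₁ ∷ u₂ ∷ u₃ ∷ u₄ ∷ r) = record
  { differ   = not-≢-self u₁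
  ; odd-cond = λ { _ 0F _ → refl ; _ (fsuc _) () }
  ; high-eq  = λ { 0F () ; 1F (s≤s ()) ; (fsuc (fsuc _)) _ → refl }
  ; pairs    = λ _ ()
  }
neighbour-AdjAt 2F u@(u₀ ∷ u₁ ∷ u₂ ∷ u₃ ∷ u₄ ∷ r) = record
  { differ   = not-≢-self u₂
  ; odd-cond = λ ()
  ; high-eq  = λ { 0F () ; 1F (s≤s ()) ; 2F (s≤s (s≤s ())) ; (fsuc (fsuc (fsuc _))) _ → refl }
  ; pairs    = λ { 0 _ _ _ j≡1 k≡0 → PairRelAt-by-toℕ u (neighbour 2F u) 1F 0F (∼-partner u₁ u₀) j≡1 k≡0
                 ; (suc _) (s≤s ()) }
  }
neighbour-AdjAt 3F u@(u₀ ∷ u₁ ∷ u₂ ∷ u₃ ∷ u₄ ∷ r) = record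
  { differ   = not-≢-self u₃
  ; odd-cond = λ { _ 2F _ → refl ; _ 0F () ; _ 1F () ; _ (fsuc (fsuc (fsuc _))) () }
  ; high-eq  = λ { 0F () ; 1F (s≤s ()) ; 2F (s≤s (s≤s ())) ; 3F (s≤s (s≤s (s≤s ())))
                 ; (fsuc (fsuc (fsuc (fsuc _)))) _ → refl }
  ; pairs    = λ { 0 _ _ _ j≡1 k≡0 → PairRelAt-by-toℕ u (neighbour 3F u) 1F 0F (∼-partner u₁ u₀) j≡1 k≡0
                 ; (suc _) (s≤s ()) }
  }
neighbour-AdjAt 4F u@(u₀ ∷ u₁ ∷ u₂ ∷ u₃ ∷ u₄ ∷ r) = record
  { differ   = not-≢-self u₄
  ; odd-cond = λ ()
  ; high-eq  = λ { 0F () ; 1F (s≤s ()) ; 2F (s≤s (s≤s ())) ; 3F (s≤s (s≤s (s≤s ())))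
                 ; 4F (s≤s (s≤s (s≤s (s≤s ())))) ; (fsuc (fsuc (fsuc (fsuc (fsuc _))))) _ → refl }
  ; pairs    = λ { 0 _ _ _ j≡1 k≡0 → PairRelAt-by-toℕ u (neighbour 4F u) 1F 0F (∼-partner u₁ u₀) j≡1 k≡0
                 ; 1 _ _ _ j≡3 k≡2 → PairRelAt-by-toℕ u (neighbour 4F u) 3F 2F (∼-partner u₃ u₂) j≡3 k≡2
                 ; (suc (suc _)) (s≤s (s≤s ())) }
  }

neighbour-adjacent : ∀ {m} (i : Fin 5) (u : Vertex (5 + m)) → CQAdj (5 + m) u (neighbour i u)
neighbour-adjacent {m} i u = i ↑ˡ m , neighbour-AdjAt i u

P4-along : ∀ {m} (i j k : Fin 5) (x : Vertex (5 + m)) {y : Vertex (5 + m)} →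
           neighbour k (neighbour j (neighbour i x)) ≡ y →
           x ≢ neighbour j (neighbour i x) → neighbour i x ≢ y → x ≢ y →
           P4 (CQAdj (5 + m)) x y
P4-along i j k x walk≡y =
  P4-from-walk CQAdj-irreflexive (neighbour-adjacent i x) (neighbour-adjacent j _)
    (subst (CQAdj _ _) walk≡y (neighbour-adjacent k _))

-- Both 4-steps twist bit 3 by bit 2, which the 2-step flips in between, so
-- exactly one of the two twists fires.
neighbour-walk-424 : ∀ {m} b c d e (r : Vec Bool m) →
                     neighbour 4F (neighbour 2F (neighbour 4F (false ∷ b ∷ not c ∷ d ∷ e ∷ r)))
                     ≡ false ∷ b ∷ c ∷ not d ∷ e ∷ r
neighbour-walk-424 b false d e r rewrite not-involutive e = refl
neighbour-walk-424 b true  d e r rewrite not-involutive e = refl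

module EvenVertex {m : ℕ} (b c d e : Bool) (r : Vec Bool m) where

  u u⁰ u¹ u² u³ : Vertex (5 + m)
  u  = false ∷ b ∷ c ∷ d ∷ e ∷ r
  u⁰ = neighbour 0F u
  u¹ = neighbour 1F u
  u² = neighbour 2F u
  u³ = neighbour 3F u

  P4-u⁰-u¹ : P4 (CQAdj (5 + m)) u⁰ u¹
  P4-u⁰-u¹ = P4-along 2F 0F 2F u⁰ (cong (λ z → false ∷ not b ∷ z ∷ d ∷ e ∷ r) (not-involutive c))
               (λ ()) (λ ()) (λ ())

  P4-u⁰-u² : P4 (CQAdj (5 + m)) u⁰ u²
  P4-u⁰-u² = P4-along 2F 0F 1F u⁰ (cong (λ z → false ∷ z ∷ not c ∷ d ∷ e ∷ r) (not-involutive b))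
               (λ ()) (λ ()) (λ ())

  P4-u⁰-u³ : P4 (CQAdj (5 + m)) u⁰ u³
  P4-u⁰-u³ = P4-along 3F 0F 1F u⁰ (cong (λ z → false ∷ z ∷ c ∷ not d ∷ e ∷ r) (not-involutive b))
               (λ ()) (λ ()) (λ ())

  P4-u¹-u² : P4 (CQAdj (5 + m)) u¹ u²
  P4-u¹-u² = P4-along 0F 2F 0F u¹ (cong (λ z → false ∷ z ∷ not c ∷ d ∷ e ∷ r) (not-involutive b))
               (λ ()) (λ ()) (lookup-≢⇒≢ 1F (not-≢-self b))

  P4-u¹-u³ : P4 (CQAdj (5 + m)) u¹ u³
  P4-u¹-u³ = P4-along 0F 3F 0F u¹ (cong (λ z → false ∷ z ∷ c ∷ not d ∷ e ∷ r) (not-involutive b))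
               (λ ()) (λ ()) (lookup-≢⇒≢ 1F (not-≢-self b))

  P4-u²-u³ : P4 (CQAdj (5 + m)) u² u³
  P4-u²-u³ = P4-along 4F 2F 4F u² (neighbour-walk-424 b c d e r)
               (lookup-≢⇒≢ 4F (not-¬ refl)) (lookup-≢⇒≢ 4F (not-≢-self e))
               (lookup-≢⇒≢ 2F (not-≢-self c))

  neighbourhood-has-K4 : HasK4 (P4GraphAdj (CQAdj (5 + m)) (CQAdj (5 + m) u))
  neighbourhood-has-K4 =
    K4-from-P4-clique (neighbour-adjacent 0F u) (neighbour-adjacent 1F u)
                      (neighbour-adjacent 2F u) (neighbour-adjacent 3F u)
                      P4-u⁰-u¹ P4-u⁰-u² P4-u⁰-u³ P4-u¹-u² P4-u¹-u³ P4-u²-u³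

lemma9 : (n : ℕ) → 5 ≤ n → (u : Vertex n) → Even u →
         HasK4 (P4GraphAdj (CQAdj n) (CQAdj n u))
lemma9 _ (s≤s (s≤s (s≤s (s≤s (s≤s z≤n))))) (u₀ ∷ b ∷ c ∷ d ∷ e ∷ r) even
  with even 0F refl
... | refl = EvenVertex.neighbourhood-has-K4 b c d e r
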